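{- Let $t,t'$ be terms and $\pi'$ a type derivation with conclusion $\Gamma\vdash t'\colon Q$. (1) If $t\to_{\bar\beta_v}t'$ then there is a derivation $\pi$ with conclusion $\Gamma\vdash t\colon Q$ such that $|\pi|=|\pi'|+1$. (2) If $t\to_{\bar\sigma}t'$ then $|\pi'|>0$ and there is a derivation $\pi$ with conclusion $\Gamma\vdash t\colon Q$ such that $|\pi|=|\pi'|$.
   Context: Terms: $t ::= x \mid \lambda x.t \mid tu$ up to $\alpha$-conversion; values are variables and abstractions. Balanced contexts: $B ::= [\cdot] \mid (\lambda x.B)t \mid Bt \mid tB$. Root rules: $(\lambda x.t)v \mapsto_{\beta_v} t\{v/x\}$ ($v$ value); $(\lambda x.t)us \mapsto_{\sigma_1} (\lambda x.ts)u$ if $x\notin\mathrm{fv}(s)$; $v((\lambda x.s)u) \mapsto_{\sigma_3} (\lambda x.vs)u$ if $v$ value and $x\notin\mathrm{fv}(v)$. $\to_{\bar\beta_v}$ is the closure of $\mapsto_{\beta_v}$ under balanced contexts and $\to_{\bar\sigma}$ the closure of $\mapsto_{\sigma_1}\cup\mapsto_{\sigma_3}$ under balanced contexts. Types: negative $N ::= P\multimap Q$; positive $P,Q ::= [N_1,\dots,N_n]$ finite multisets ($n\ge0$), $\mathbf{0}$ the empty multiset. Environments: maps from variables to positive types, $\mathbf{0}$ almost everywhere; $\uplus$ pointwise multiset sum. Rules: (ax) $x\colon P\vdash x\colon P$; (@) from $\Gamma\vdash t\colon[P\multimap Q]$ and $\Gamma'\vdash u\colon P$ infer $\Gamma\uplus\Gamma'\vdash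 tu\colon Q$; ($\lambda$) for $n\ge0$, from $\Gamma_i,x\colon P_i\vdash t\colon Q_i$ ($1\le i\le n$) infer $\biguplus_i\Gamma_i\vdash\lambda x.t\colon[P_1\multimap Q_1,\dots,P_n\multimap Q_n]$. $|\pi|$ is the number of (@) rules in $\pi$. -}

module Defs where

open import Data.Nat using (ℕ; zero; suc; _+_)
open import Data.List using (List; []; _∷_; _++_)

-- Terms of the untyped λ-calculus, de Bruijn indices (terms up to α).

data Term : Set where
  var : ℕ → Term
  lam : Term → Term
  app : Term → Term → Term

data Value : Term → Set where
  var-val : ∀ x → Value (var x)
  lam-val : ∀ t → Value (lam t)

ext : (ℕ → ℕ) → ℕ → ℕ
ext ρ zero    = zero
ext ρ (suc n) = suc (ρ n)

rename : (ℕ → ℕ) → Term → Term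
rename ρ (var x)   = var (ρ x)
rename ρ (lam t)   = lam (rename (ext ρ) t)
rename ρ (app t u) = app (rename ρ t) (rename ρ u)

shift : Term → Term
shift = rename suc

exts : (ℕ → Term) → ℕ → Term
exts σ zero    = var zero
exts σ (suc n) = shift (σ n)

subst : (ℕ → Term) → Term → Term
subst σ (var x)   = σ x
subst σ (lam t)   = lam (subst (exts σ) t)
subst σ (app t u) = app (subst σ t) (subst σ u)

-- t{v/x}: substitute v for the bound variable 0 (others decremented)
sub0 : Term → ℕ → Term
sub0 v zero    = v
sub0 v (suc n) = var n

_[_] : Term → Term → Term
t [ v ] = subst (sub0 v) t

-- Root rules.  Side conditions x ∉ fv(s), x ∉ fv(v) are built in by
-- shifting the term moved under the binder.

data _↦βv_ : Term → Term → Set where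
  βv : ∀ {t v} → Value v → app (lam t) v ↦βv (t [ v ])

data _↦σ_ : Term → Term → Set where
  σ₁ : ∀ {t u s} → app (app (lam t) u) s ↦σ app (lam (app t (shift s))) u
  σ₃ : ∀ {v s u} → Value v →
       app v (app (lam s) u) ↦σ app (lam (app (shift v) s)) u

-- closure under balanced contexts B ::= [·] | (λx.B)t | B t | t B
data BalClos (R : Term → Term → Set) : Term → Term → Set where
  root : ∀ {t t'} → R t t' → BalClos R t t'
  lamB : ∀ {t t' u} → BalClos R t t' → BalClos R (app (lam t) u) (app (lam t') u)
  appL : ∀ {t t' u} → BalClos R t t' → BalClos R (app t u) (app t' u)
  appR : ∀ {t u u'} → BalClos R u u' → BalClos R (app t u) (app t u')

_→β̄v_ : Term → Term → Set
_→β̄v_ = BalClos _↦βv_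

_→σ̄_ : Term → Term → Set
_→σ̄_ = BalClos _↦σ_

-- Types.  Positive types are finite multisets of negative types,
-- represented by lists and identified up to (deep) permutation ≈P.

data Neg : Set where
  _⊸_ : List Neg → List Neg → Neg

Pos : Set
Pos = List Neg

𝟎 : Pos
𝟎 = []

mutual
  data _≈N_ : Neg → Neg → Set where
    ⊸-cong : ∀ {P P' Q Q'} → P ≈P P' → Q ≈P Q' → (P ⊸ Q) ≈N (P' ⊸ Q')

  -- multiset equality (permutation modulo ≈N), as in
  -- Data.List.Relation.Binary.Permutation.Setoid
  data _≈P_ : Pos → Pos → Set where
    nil   : [] ≈P []
    prep  : ∀ {N N' P P'} → N ≈N N' → P ≈P P' → (N ∷ P) ≈P (N' ∷ P')
    swap  : ∀ {N N' M M' P P'} → N ≈N N' → M ≈N M' → P ≈P P' →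
            (N ∷ M ∷ P) ≈P (M' ∷ N' ∷ P')
    trans : ∀ {P Q R} → P ≈P Q → Q ≈P R → P ≈P R

Env : Set
Env = ℕ → Pos

∅ : Env
∅ _ = 𝟎

_⊎_ : Env → Env → Env
(Γ ⊎ Δ) x = Γ x ++ Δ x

_≈E_ : Env → Env → Set
Γ ≈E Δ = ∀ x → Γ x ≈P Δ x

[_∶_] : ℕ → Pos → Env
[ zero  ∶ P ] zero    = P
[ zero  ∶ P ] (suc y) = 𝟎
[ suc x ∶ P ] zero    = 𝟎
[ suc x ∶ P ] (suc y) = [ x ∶ P ] y

-- Γ, x : P  (x the variable bound by the enclosing λ, i.e. index 0)
_▸_ : Env → Pos → Env
(Γ ▸ P) zero    = P
(Γ ▸ P) (suc y) = Γ y

-- Type derivations.  Since types/environments are multisets, each rule's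
-- conclusion is taken up to multiset equality.

mutual
  data _⊢_∶_ : Env → Term → Pos → Set where
    ax  : ∀ {Γ x P} → Γ ≈E [ x ∶ P ] → Γ ⊢ var x ∶ P
    appr  : ∀ {Γ Γ' Δ t u P Q Q'} →
          Γ ⊢ t ∶ ((P ⊸ Q) ∷ []) → Γ' ⊢ u ∶ P →
          Δ ≈E (Γ ⊎ Γ') → Q' ≈P Q → Δ ⊢ app t u ∶ Q'
    λr  : ∀ {Γ Δ t R R'} → LamPrems t Γ R →
          Δ ≈E Γ → R' ≈P R → Δ ⊢ lam t ∶ R'

  -- the n ≥ 0 premises Γᵢ, x : Pᵢ ⊢ t : Qᵢ of the λ rule, with
  -- accumulated environment ⊎ᵢ Γᵢ and type [P₁ ⊸ Q₁, …, Pₙ ⊸ Qₙ]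
  data LamPrems (t : Term) : Env → Pos → Set where
    none : LamPrems t ∅ []
    more : ∀ {Γ Δ P Q R} → (Γ ▸ P) ⊢ t ∶ Q → LamPrems t Δ R →
           LamPrems t (Γ ⊎ Δ) ((P ⊸ Q) ∷ R)

mutual
  size : ∀ {Γ t P} → Γ ⊢ t ∶ P → ℕ
  size (ax _)           = 0
  size (appr π ρ _ _)     = suc (size π + size ρ)
  size (λr ps _ _)      = sizePs ps

  sizePs : ∀ {t Γ R} → LamPrems t Γ R → ℕ
  sizePs none        = 0
  sizePs (more π ps) = size π + sizePs ps

-- β_v-expansion is anti-substitution.  A derivation of t{v/x} splits into a
-- derivation of t in which x receives the multiset P of the types assigned to
-- the occurrences of v, plus a derivation of v : P.  The latter exists because
-- a value is typable with 𝟎 by a derivation without (@) rules, and two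
-- derivations of the same value merge into one whose type and environment are
-- the sums of theirs and whose size is the sum of their sizes.  Re-inserting
-- the redex (λx.t)v then costs exactly one (@) rule.  The σ-rules only
-- rearrange the (@) rules of a derivation, keeping environments up to
-- multiset equality: the subterm moved out of the scope of x does not
-- mention x, so its derivation gives x the type 𝟎 and can be strengthened.
module Submission where

open import Defs
open import Algebra.Bundles using (CommutativeMonoid)
import Algebra.Construct.Pointwise as Pointwise
import Algebra.Properties.CommutativeSemigroup as CommutativeSemigroupProperties
open import Data.Nat using (ℕ; zero; suc; _+_; _<_; s≤s; z≤n)
open import Data.Nat.Properties using (+-identityʳ; +-assoc)
open import Data.Nat.Tactic.RingSolver using (solve-∀)
open import Data.List using ([]; _∷_; _++_)
import Data.List.Properties as List
open import Data.Product using (Σ; ∃; _×_; _,_)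
open import Function using (_∘_)
open import Relation.Binary.Definitions using (Reflexive; Symmetric; Transitive)
open import Relation.Binary.Structures using (IsEquivalence)
open import Relation.Binary.PropositionalEquality
  using (_≡_; refl; cong; cong₂; module ≡-Reasoning)
import Relation.Binary.PropositionalEquality as Eq

private
  variable
    Γ Γ' Γ₁ Γ₂ Δ : Env
    N : Neg
    P P' Q Q' R R' : Pos
    t t' u v : Term

mutual
  ≈N-refl : Reflexive _≈N_
  ≈N-refl {P ⊸ Q} = ⊸-cong ≈P-refl ≈P-refl

  ≈P-refl : Reflexive _≈P_
  ≈P-refl {[]}    = nil
  ≈P-refl {N ∷ P} = prep ≈N-refl ≈P-refl

mutual
  ≈N-sym : Symmetric _≈N_
  ≈N-sym (⊸-cong p q) = ⊸-cong (≈P-sym p) (≈P-sym q)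

  ≈P-sym : Symmetric _≈P_
  ≈P-sym nil          = nil
  ≈P-sym (prep n p)   = prep (≈N-sym n) (≈P-sym p)
  ≈P-sym (swap n m p) = swap (≈N-sym m) (≈N-sym n) (≈P-sym p)
  ≈P-sym (trans p q)  = trans (≈P-sym q) (≈P-sym p)

≈N-trans : Transitive _≈N_
≈N-trans (⊸-cong p q) (⊸-cong p' q') = ⊸-cong (trans p p') (trans q q')

≈P-isEquivalence : IsEquivalence _≈P_
≈P-isEquivalence = record { refl = ≈P-refl ; sym = ≈P-sym ; trans = trans }

≡⇒≈P : P ≡ Q → P ≈P Q
≡⇒≈P refl = ≈P-refl

++-cong : P ≈P P' → Q ≈P Q' → (P ++ Q) ≈P (P' ++ Q')
++-cong nil          q = q
++-cong (prep n p)   q = prep n (++-cong p q)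
++-cong (swap n m p) q = swap n m (++-cong p q)
++-cong (trans p p') q = trans (++-cong p ≈P-refl) (++-cong p' q)

≈P-shift : ∀ P N Q → (P ++ N ∷ Q) ≈P (N ∷ P ++ Q)
≈P-shift []      N Q = ≈P-refl
≈P-shift (M ∷ P) N Q = trans (prep ≈N-refl (≈P-shift P N Q)) (swap ≈N-refl ≈N-refl ≈P-refl)

++-comm : ∀ P Q → (P ++ Q) ≈P (Q ++ P)
++-comm []      Q = ≡⇒≈P (Eq.sym (List.++-identityʳ Q))
++-comm (N ∷ P) Q = trans (prep ≈N-refl (++-comm P Q)) (≈P-sym (≈P-shift Q N P))

Pos-commutativeMonoid : CommutativeMonoid _ _
Pos-commutativeMonoid = record
  { Carrier             = Pos
  ; _≈_                 = _≈P_
  ; _∙_                 = _++_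
  ; ε                   = 𝟎
  ; isCommutativeMonoid = record
    { isMonoid = record
      { isSemigroup = record
        { isMagma = record { isEquivalence = ≈P-isEquivalence ; ∙-cong = ++-cong }
        ; assoc   = λ P Q R → ≡⇒≈P (List.++-assoc P Q R)
        }
      ; identity = (λ _ → ≈P-refl) , (λ P → ≡⇒≈P (List.++-identityʳ P))
      }
    ; comm = ++-comm
    }
  }

𝟎-≈P-inv : 𝟎 ≈P P → P ≡ 𝟎
𝟎-≈P-inv nil = refl
𝟎-≈P-inv (trans p q) with 𝟎-≈P-inv p
... | refl = 𝟎-≈P-inv q

singleton-≈P-inv : (N ∷ []) ≈P P → ∃ λ M → P ≡ M ∷ [] × N ≈N M
singleton-≈P-inv (prep n p) with 𝟎-≈P-inv p
... | refl = _ , refl , n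
singleton-≈P-inv (trans p q) with singleton-≈P-inv p
... | _ , refl , n with singleton-≈P-inv q
...   | _ , refl , m = _ , refl , ≈N-trans n m

-- The pointwise lifting of (Pos, ++, ≈P) is definitionally (Env, ⊎, ≈E).
Env-commutativeMonoid : CommutativeMonoid _ _
Env-commutativeMonoid = Pointwise.commutativeMonoid ℕ Pos-commutativeMonoid

open CommutativeMonoid Env-commutativeMonoid using (assoc; comm; identityʳ)
  renaming (refl to ≈E-refl; sym to ≈E-sym; trans to ≈E-trans; ∙-cong to ⊎-cong)
open CommutativeSemigroupProperties
  (CommutativeMonoid.commutativeSemigroup Env-commutativeMonoid)
  using (interchange; xy∙z≈xz∙y)

▸-cong : Γ ≈E Δ → P ≈P Q → (Γ ▸ P) ≈E (Δ ▸ Q)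
▸-cong e p zero    = p
▸-cong e p (suc x) = e x

▸-split : (Γ ▸ P) ≈E (Γ₁ ⊎ Γ₂) → Γ₂ 0 ≈P 𝟎 → Γ₁ ≈E ((Γ₁ ∘ suc) ▸ P)
▸-split {Γ₁ = Γ₁} e z zero =
  trans (≡⇒≈P (Eq.sym (List.++-identityʳ (Γ₁ 0)))) (trans (++-cong ≈P-refl (≈P-sym z)) (≈P-sym (e 0)))
▸-split e z (suc x) = ≈P-refl

[∶]-cong : ∀ x → P ≈P P' → [ x ∶ P ] ≈E [ x ∶ P' ]
[∶]-cong zero    p zero    = p
[∶]-cong zero    p (suc y) = nil
[∶]-cong (suc x) p zero    = nil
[∶]-cong (suc x) p (suc y) = [∶]-cong x p y

[∶]-⊎ : ∀ x → ([ x ∶ P ] ⊎ [ x ∶ P' ]) ≈E [ x ∶ P ++ P' ]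
[∶]-⊎ zero    zero    = ≈P-refl
[∶]-⊎ zero    (suc y) = nil
[∶]-⊎ (suc x) zero    = nil
[∶]-⊎ (suc x) (suc y) = [∶]-⊎ x y

[∶𝟎]≈∅ : ∀ x → [ x ∶ 𝟎 ] ≈E ∅
[∶𝟎]≈∅ zero    zero    = nil
[∶𝟎]≈∅ zero    (suc y) = nil
[∶𝟎]≈∅ (suc x) zero    = nil
[∶𝟎]≈∅ (suc x) (suc y) = [∶𝟎]≈∅ x y

infix 4 _⊢_∶_#_

_⊢_∶_#_ : Env → Term → Pos → ℕ → Set
Γ ⊢ t ∶ P # n = Σ (Γ ⊢ t ∶ P) (λ π → size π ≡ n)

cast : Γ ≈E Γ' → P ≈P P' → Γ ⊢ t ∶ P → Γ' ⊢ t ∶ P'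
cast e p (ax {x = x} e')     = ax (≈E-trans (≈E-sym e) (≈E-trans e' ([∶]-cong x p)))
cast e p (appr π₁ π₂ e' p') = appr π₁ π₂ (≈E-trans (≈E-sym e) e') (trans (≈P-sym p) p')
cast e p (λr ps e' p')      = λr ps (≈E-trans (≈E-sym e) e') (trans (≈P-sym p) p')

size-cast : (e : Γ ≈E Γ') (p : P ≈P P') (π : Γ ⊢ t ∶ P) → size (cast e p π) ≡ size π
size-cast e p (ax _)           = refl
size-cast e p (appr _ _ _ _) = refl
size-cast e p (λr _ _ _)     = refl

app₁ : Γ ⊢ t ∶ ((P ⊸ Q) ∷ []) → Γ' ⊢ u ∶ P → (Γ ⊎ Γ') ⊢ app t u ∶ Q
app₁ π₁ π₂ = appr π₁ π₂ ≈E-refl ≈P-refl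

lam₁ : (Γ ▸ P) ⊢ t ∶ Q → Γ ⊢ lam t ∶ ((P ⊸ Q) ∷ [])
lam₁ π = λr (more π none) (≈E-sym (identityʳ _)) ≈P-refl

size-lam₁ : (π : (Γ ▸ P) ⊢ t ∶ Q) → size (lam₁ π) ≡ size π
size-lam₁ π = +-identityʳ (size π)

lam₁-inv : (π : Δ ⊢ lam t ∶ ((P ⊸ Q) ∷ [])) → (Δ ▸ P) ⊢ t ∶ Q # size π
lam₁-inv (λr ps e p) with singleton-≈P-inv p
... | _ , refl , ⊸-cong p₁ q₁ with ps
...   | more π none =
  cast (▸-cong (≈E-sym (≈E-trans e (identityʳ _))) (≈P-sym p₁)) (≈P-sym q₁) π ,
  Eq.trans (size-cast _ _ π) (Eq.sym (+-identityʳ (size π)))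

app-size-pos : (π : Γ ⊢ app t u ∶ Q) → 0 < size π
app-size-pos (appr _ _ _ _) = s≤s z≤n

-- skip j renames the variables of a term so that index j becomes fresh.
skip : ℕ → ℕ → ℕ
skip zero    = suc
skip (suc j) = ext (skip j)

[∶]-skip-fresh : ∀ j x → [ skip j x ∶ P ] j ≡ 𝟎
[∶]-skip-fresh zero    x       = refl
[∶]-skip-fresh (suc j) zero    = refl
[∶]-skip-fresh (suc j) (suc x) = [∶]-skip-fresh j x

[∶]-skip : ∀ j x → ([ skip j x ∶ P ] ∘ skip j) ≈E [ x ∶ P ]
[∶]-skip zero    x       y       = ≈P-refl
[∶]-skip (suc j) zero    zero    = ≈P-refl
[∶]-skip (suc j) zero    (suc y) = ≈P-refl
[∶]-skip (suc j) (suc x) zero    = ≈P-refl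
[∶]-skip (suc j) (suc x) (suc y) = [∶]-skip j x y

▸-skip : ∀ j → ((Γ ▸ P) ∘ skip (suc j)) ≈E ((Γ ∘ skip j) ▸ P)
▸-skip j zero    = ≈P-refl
▸-skip j (suc x) = ≈P-refl

mutual
  strengthen : ∀ j t (π : Δ ⊢ rename (skip j) t ∶ Q) →
               Δ j ≈P 𝟎 × (Δ ∘ skip j) ⊢ t ∶ Q # size π
  strengthen j (var x) (ax e) =
    trans (e j) (≡⇒≈P ([∶]-skip-fresh j x)) ,
    ax (λ y → trans (e (skip j y)) ([∶]-skip j x y)) , refl
  strengthen j (app t u) (appr π₁ π₂ e p) with strengthen j t π₁ | strengthen j u π₂
  ... | z₁ , π₁' , s₁ | z₂ , π₂' , s₂ =
    trans (e j) (++-cong z₁ z₂) ,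
    appr π₁' π₂' (e ∘ skip j) p , cong₂ (λ m n → suc (m + n)) s₁ s₂
  strengthen j (lam t) (λr ps e p) with strengthen-prems j t ps
  ... | z , ps' , s = trans (e j) z , λr ps' (e ∘ skip j) p , s

  strengthen-prems : ∀ j t (ps : LamPrems (rename (skip (suc j)) t) Γ R) →
                     Γ j ≈P 𝟎 × Σ (LamPrems t (Γ ∘ skip j) R) (λ ps' → sizePs ps' ≡ sizePs ps)
  strengthen-prems j t none = nil , none , refl
  strengthen-prems j t (more π ps) with strengthen (suc j) t π | strengthen-prems j t ps
  ... | z₁ , π' , s₁ | z₂ , ps' , s₂ =
    ++-cong z₁ z₂ ,
    more (cast (▸-skip j) ≈P-refl π') ps' ,
    cong₂ _+_ (Eq.trans (size-cast _ _ π') s₁) s₂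

value-⊢𝟎 : Value v → ∅ ⊢ v ∶ 𝟎 # 0
value-⊢𝟎 (var-val x) = ax (≈E-sym ([∶𝟎]≈∅ x)) , refl
value-⊢𝟎 (lam-val t) = λr none ≈E-refl nil , refl

LamPrems-++ : (ps₁ : LamPrems t Γ₁ R) (ps₂ : LamPrems t Γ₂ R') →
              ∃ λ Γ → Γ ≈E (Γ₁ ⊎ Γ₂) ×
                Σ (LamPrems t Γ (R ++ R')) (λ ps → sizePs ps ≡ sizePs ps₁ + sizePs ps₂)
LamPrems-++ none ps₂ = _ , ≈E-refl , ps₂ , refl
LamPrems-++ (more {Γ} {Γ₁} π ps₁) ps₂ with LamPrems-++ ps₁ ps₂
... | _ , e , ps , s =
  _ , ≈E-trans (⊎-cong (≈E-refl {Γ}) e) (≈E-sym (assoc Γ Γ₁ _)) ,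
  more π ps , Eq.trans (cong (size π +_) s) (Eq.sym (+-assoc (size π) (sizePs ps₁) (sizePs ps₂)))

value-merge : Value v → (π₁ : Γ₁ ⊢ v ∶ P) (π₂ : Γ₂ ⊢ v ∶ Q) →
              (Γ₁ ⊎ Γ₂) ⊢ v ∶ P ++ Q # size π₁ + size π₂
value-merge (var-val x) (ax e₁) (ax e₂) = ax (≈E-trans (⊎-cong e₁ e₂) ([∶]-⊎ x)) , refl
value-merge (lam-val t) (λr ps₁ e₁ p₁) (λr ps₂ e₂ p₂) with LamPrems-++ ps₁ ps₂
... | _ , e , ps , s = λr ps (≈E-trans (⊎-cong e₁ e₂) (≈E-sym e)) (++-cong p₁ p₂) , s

-- substAt k v substitutes v for index k under k binders; insertAt k and
-- padEnv k are its counterparts on environments.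
substAt : ℕ → Term → ℕ → Term
substAt zero    v = sub0 v
substAt (suc k) v = exts (substAt k v)

insertAt : ℕ → Pos → Env → Env
insertAt zero    P Γ = Γ ▸ P
insertAt (suc k) P Γ = insertAt k P (Γ ∘ suc) ▸ Γ 0

padEnv : ℕ → Env → Env
padEnv zero    Γ = Γ
padEnv (suc k) Γ = padEnv k Γ ▸ 𝟎

insertAt-⊎ : ∀ k Γ Γ' → insertAt k (P ++ P') (Γ ⊎ Γ') ≈E (insertAt k P Γ ⊎ insertAt k P' Γ')
insertAt-⊎ zero    Γ Γ' zero    = ≈P-refl
insertAt-⊎ zero    Γ Γ' (suc x) = ≈P-refl
insertAt-⊎ (suc k) Γ Γ' zero    = ≈P-refl
insertAt-⊎ (suc k) Γ Γ' (suc x) = insertAt-⊎ k (Γ ∘ suc) (Γ' ∘ suc) x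

insertAt-𝟎-∅ : ∀ k → Γ ≈E ∅ → insertAt k 𝟎 Γ ≈E ∅
insertAt-𝟎-∅ zero    e zero    = nil
insertAt-𝟎-∅ zero    e (suc x) = e x
insertAt-𝟎-∅ (suc k) e zero    = e zero
insertAt-𝟎-∅ (suc k) e (suc x) = insertAt-𝟎-∅ k (e ∘ suc) x

padEnv-⊎ : ∀ k Γ Γ' → (padEnv k Γ ⊎ padEnv k Γ') ≈E padEnv k (Γ ⊎ Γ')
padEnv-⊎ zero    Γ Γ' x       = ≈P-refl
padEnv-⊎ (suc k) Γ Γ' zero    = nil
padEnv-⊎ (suc k) Γ Γ' (suc x) = padEnv-⊎ k Γ Γ' x

padEnv-∅ : ∀ k → padEnv k ∅ ≈E ∅
padEnv-∅ zero    x       = nil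
padEnv-∅ (suc k) zero    = nil
padEnv-∅ (suc k) (suc x) = padEnv-∅ k x

record AntiSubst (k : ℕ) (t v : Term) (Δ : Env) (Q : Pos) (n : ℕ) : Set where
  constructor antiSubst
  field
    Γt Γv     : Env
    Px        : Pos
    πt        : insertAt k Px Γt ⊢ t ∶ Q
    πv        : Γv ⊢ v ∶ Px
    env-split : Δ ≈E (Γt ⊎ padEnv k Γv)
    size-sum  : size πt + size πv ≡ n

record AntiSubstPrems (k : ℕ) (t v : Term) (Δ : Env) (R : Pos) (n : ℕ) : Set where
  constructor antiSubstPrems
  field
    Γt Γv Γps : Env
    Px        : Pos
    ps        : LamPrems t Γps R
    ps-env    : Γps ≈E insertAt k Px Γt
    πv        : Γv ⊢ v ∶ Px
    env-split : Δ ≈E (Γt ⊎ padEnv k Γv)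
    size-sum  : sizePs ps + size πv ≡ n

merge-splits : ∀ k {Δ Γ₁ Γ₂ Γt Γv Γt' Γv'} → Δ ≈E (Γ₁ ⊎ Γ₂) →
               Γ₁ ≈E (Γt ⊎ padEnv k Γv) → Γ₂ ≈E (Γt' ⊎ padEnv k Γv') →
               Δ ≈E ((Γt ⊎ Γt') ⊎ padEnv k (Γv ⊎ Γv'))
merge-splits k {Γt = Γt} {Γv} {Γt'} {Γv'} e e₁ e₂ = ≈E-trans e (≈E-trans (⊎-cong e₁ e₂)
  (≈E-trans (interchange Γt (padEnv k Γv) Γt' (padEnv k Γv'))
            (⊎-cong (≈E-refl {Γt ⊎ Γt'}) (padEnv-⊎ k Γv Γv'))))

+-interchange : ∀ a b c d → (a + b) + (c + d) ≡ (a + c) + (b + d)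
+-interchange = solve-∀

antiSubst-app : ∀ k {t u} → Value v → (π₁ : Γ₁ ⊢ subst (substAt k v) t ∶ ((P ⊸ Q) ∷ []))
  (π₂ : Γ₂ ⊢ subst (substAt k v) u ∶ P) (e : Δ ≈E (Γ₁ ⊎ Γ₂)) (q : Q' ≈P Q) →
  AntiSubst k t v Γ₁ ((P ⊸ Q) ∷ []) (size π₁) → AntiSubst k u v Γ₂ P (size π₂) →
  AntiSubst k (app t u) v Δ Q' (size (appr π₁ π₂ e q))
antiSubst-app k val π₁ π₂ e q (antiSubst Γt Γv P πt πv e₁ s₁) (antiSubst Γt' Γv' P' πt' πv' e₂ s₂)
  with value-merge val πv πv'
... | πv'' , s = antiSubst (Γt ⊎ Γt') (Γv ⊎ Γv') (P ++ P')
  (appr πt πt' (insertAt-⊎ k Γt Γt') q) πv'' (merge-splits k e e₁ e₂) (cong suc size-eq)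
  where
  open ≡-Reasoning
  size-eq : size πt + size πt' + size πv'' ≡ size π₁ + size π₂
  size-eq = begin
    size πt + size πt' + size πv''                      ≡⟨ cong (size πt + size πt' +_) s ⟩
    size πt + size πt' + (size πv + size πv')           ≡⟨ +-interchange (size πt) _ _ _ ⟩
    (size πt + size πv) + (size πt' + size πv')         ≡⟨ cong₂ _+_ s₁ s₂ ⟩
    size π₁ + size π₂                                   ∎

antiSubst-lam : ∀ k {t} (ps : LamPrems (subst (substAt (suc k) v) t) Γ R)
  (e : Δ ≈E Γ) (q : Q ≈P R) → AntiSubstPrems k t v Γ R (sizePs ps) →
  AntiSubst k (lam t) v Δ Q (size (λr ps e q))
antiSubst-lam k ps e q (antiSubstPrems Γt Γv Γps P ps' e-ps πv e' s) =
  antiSubst Γt Γv P (λr ps' (≈E-sym e-ps) q) πv (≈E-trans e e') s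

antiSubstPrems-none : ∀ k {t} → Value v → AntiSubstPrems k t v ∅ 𝟎 0
antiSubstPrems-none k val with value-⊢𝟎 val
... | πv , s = antiSubstPrems ∅ ∅ ∅ 𝟎 none (≈E-sym (insertAt-𝟎-∅ k ≈E-refl)) πv
  (≈E-sym (padEnv-∅ k)) s

antiSubstPrems-more : ∀ k {t Γᵢ Γs Pᵢ Qᵢ} → Value v →
  (π : (Γᵢ ▸ Pᵢ) ⊢ subst (substAt (suc k) v) t ∶ Qᵢ)
  (ps : LamPrems (subst (substAt (suc k) v) t) Γs R) →
  AntiSubst (suc k) t v (Γᵢ ▸ Pᵢ) Qᵢ (size π) → AntiSubstPrems k t v Γs R (sizePs ps) →
  AntiSubstPrems k t v (Γᵢ ⊎ Γs) ((Pᵢ ⊸ Qᵢ) ∷ R) (sizePs (more π ps))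
antiSubstPrems-more k {t} {Pᵢ = Pᵢ} {Qᵢ} val π ps (antiSubst Γt Γv P πt πv e₁ s₁)
                              (antiSubstPrems Γt' Γv' Γps P' ps' e-ps πv' e₂ s₂)
  with value-merge val πv πv'
... | πv'' , s = antiSubstPrems ((Γt ∘ suc) ⊎ Γt') (Γv ⊎ Γv') _ (P ++ P')
  (more πt' ps') (≈E-trans (⊎-cong (≈E-refl {insertAt k P (Γt ∘ suc)}) e-ps)
                           (≈E-sym (insertAt-⊎ k (Γt ∘ suc) Γt')))
  πv'' (merge-splits k ≈E-refl (e₁ ∘ suc) e₂) size-eq
  where
  πt' : (insertAt k P (Γt ∘ suc) ▸ Pᵢ) ⊢ t ∶ Qᵢ
  πt' = cast (▸-cong ≈E-refl (trans (≡⇒≈P (Eq.sym (List.++-identityʳ (Γt 0)))) (≈P-sym (e₁ 0)))) ≈P-refl πt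
  open ≡-Reasoning
  size-eq : size πt' + sizePs ps' + size πv'' ≡ size π + sizePs ps
  size-eq = begin
    size πt' + sizePs ps' + size πv''                   ≡⟨ cong₂ (λ m n → m + sizePs ps' + n) (size-cast _ _ πt) s ⟩
    size πt + sizePs ps' + (size πv + size πv')         ≡⟨ +-interchange (size πt) _ _ _ ⟩
    (size πt + size πv) + (sizePs ps' + size πv')       ≡⟨ cong₂ _+_ s₁ s₂ ⟩
    size π + sizePs ps                                  ∎

antiSubst-var-hit : (π : Δ ⊢ v ∶ Q) → AntiSubst 0 (var 0) v Δ Q (size π)
antiSubst-var-hit {Δ = Δ} {Q = Q} π = antiSubst ∅ Δ Q (ax ax-env) π (λ _ → ≈P-refl) refl
  where
  ax-env : (∅ ▸ Q) ≈E [ 0 ∶ Q ]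
  ax-env zero    = ≈P-refl
  ax-env (suc y) = nil

antiSubst-var-miss : ∀ n → Value v → (π : Δ ⊢ var n ∶ Q) → AntiSubst 0 (var (suc n)) v Δ Q (size π)
antiSubst-var-miss {Δ = Δ} n val (ax e) with value-⊢𝟎 val
... | πv , s = antiSubst Δ ∅ 𝟎 (ax (λ { zero → nil ; (suc y) → e y })) πv
  (≈E-sym (identityʳ Δ)) s

antiSubst-var-bound : ∀ k → Value v → (π : Δ ⊢ var 0 ∶ Q) → AntiSubst (suc k) (var 0) v Δ Q (size π)
antiSubst-var-bound {Δ = Δ} k val (ax e) with value-⊢𝟎 val
... | πv , s = antiSubst Δ ∅ 𝟎 (ax (λ { zero → e zero ; (suc y) → insertAt-𝟎-∅ k (e ∘ suc) y }))
  πv (≈E-sym (≈E-trans (⊎-cong (≈E-refl {Δ}) (padEnv-∅ (suc k))) (identityʳ Δ))) s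

antiSubst-var-shift : ∀ k n (π : Δ ⊢ shift (substAt k v n) ∶ Q) → Δ 0 ≈P 𝟎 →
  (π₀ : (Δ ∘ suc) ⊢ substAt k v n ∶ Q) → size π₀ ≡ size π →
  AntiSubst k (var n) v (Δ ∘ suc) Q (size π₀) → AntiSubst (suc k) (var (suc n)) v Δ Q (size π)
antiSubst-var-shift k n π z π₀ s₀ (antiSubst Γt Γv P (ax e) πv e' s) =
  antiSubst (Γt ▸ 𝟎) Γv P (ax (λ { zero → nil ; (suc y) → e y })) πv
    (λ { zero → z ; (suc y) → e' y }) (Eq.trans s s₀)

mutual
  anti-substitution : ∀ k t → Value v → (π : Δ ⊢ subst (substAt k v) t ∶ Q) →
                      AntiSubst k t v Δ Q (size π)
  anti-substitution zero    (var zero)    val π = antiSubst-var-hit π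
  anti-substitution zero    (var (suc n)) val π = antiSubst-var-miss n val π
  anti-substitution (suc k) (var zero)    val π = antiSubst-var-bound k val π
  anti-substitution {v = v} (suc k) (var (suc n)) val π
    = let z , π₀ , s₀ = strengthen 0 (substAt k v n) π
      in antiSubst-var-shift k n π z π₀ s₀ (anti-substitution k (var n) val π₀)
  anti-substitution k (app t u) val (appr π₁ π₂ e q) =
    antiSubst-app k val π₁ π₂ e q (anti-substitution k t val π₁) (anti-substitution k u val π₂)
  anti-substitution k (lam t) val (λr ps e q) =
    antiSubst-lam k ps e q (anti-substitution-prems k t val ps)

  anti-substitution-prems : ∀ k t → Value v → (ps : LamPrems (subst (substAt (suc k) v) t) Γ R) →
                            AntiSubstPrems k t v Γ R (sizePs ps)
  anti-substitution-prems k t val none        = antiSubstPrems-none k val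
  anti-substitution-prems k t val (more π ps) =
    antiSubstPrems-more k val π ps (anti-substitution (suc k) t val π) (anti-substitution-prems k t val ps)

_Expands-by_ : (Term → Term → Set) → ℕ → Set
_↝_ Expands-by k = ∀ {Δ t t' Q} → t ↝ t' → (π' : Δ ⊢ t' ∶ Q) → Δ ⊢ t ∶ Q # k + size π'

↦βv-expands : _↦βv_ Expands-by 1
↦βv-expands (βv {t} val) π' with anti-substitution 0 t val π'
... | antiSubst Γt Γv P πt πv e s =
  cast (≈E-sym e) ≈P-refl (app₁ (lam₁ πt) πv) , size-eq
  where
  open ≡-Reasoning
  size-eq : size (cast (≈E-sym e) ≈P-refl (app₁ (lam₁ πt) πv)) ≡ suc (size π')
  size-eq = begin
    size (cast (≈E-sym e) ≈P-refl (app₁ (lam₁ πt) πv)) ≡⟨ size-cast (≈E-sym e) ≈P-refl (app₁ (lam₁ πt) πv) ⟩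
    suc (size (lam₁ πt) + size πv)                        ≡⟨ cong (λ m → suc (m + size πv)) (size-lam₁ πt) ⟩
    suc (size πt + size πv)                               ≡⟨ cong suc s ⟩
    suc (size π')                                         ∎

σ₁-expand : ∀ {Γ₁ Γ₂ Δ P Q Q' t u s} (π₁ : Γ₁ ⊢ lam (app t (shift s)) ∶ ((P ⊸ Q) ∷ [])) (πu : Γ₂ ⊢ u ∶ P)
  (e : Δ ≈E (Γ₁ ⊎ Γ₂)) (q : Q' ≈P Q) (πb : (Γ₁ ▸ P) ⊢ app t (shift s) ∶ Q) → size πb ≡ size π₁ →
  Δ ⊢ app (app (lam t) u) s ∶ Q' # size (appr π₁ πu e q)
σ₁-expand {Γ₂ = Γ₂} {Δ = Δ} {P = P} {t = t} {u = u} {s = s} π₁ πu e q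
          (appr {Γ = Γ₃} {Γ' = Γ₄} {P = Pₛ} {Q = Qₜ} πt πs e' q') sb
  with strengthen 0 s πs
... | z , πs₀ , ss =
  cast env (≈P-sym (trans q q')) π , size-eq
  where
  πt' : ((Γ₃ ∘ suc) ▸ P) ⊢ t ∶ ((Pₛ ⊸ Qₜ) ∷ [])
  πt' = cast (▸-split e' z) ≈P-refl πt
  π : (((Γ₃ ∘ suc) ⊎ Γ₂) ⊎ (Γ₄ ∘ suc)) ⊢ app (app (lam t) u) s ∶ Qₜ
  π = app₁ (app₁ (lam₁ πt') πu) πs₀
  env : (((Γ₃ ∘ suc) ⊎ Γ₂) ⊎ (Γ₄ ∘ suc)) ≈E Δ
  env = ≈E-sym (≈E-trans e (≈E-trans (⊎-cong (e' ∘ suc) (≈E-refl {Γ₂}))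
                                      (xy∙z≈xz∙y (Γ₃ ∘ suc) (Γ₄ ∘ suc) Γ₂)))
  shuffle : ∀ a b c → suc (suc (a + b) + c) ≡ suc (suc (a + c) + b)
  shuffle = solve-∀
  open ≡-Reasoning
  size-eq : size (cast env (≈P-sym (trans q q')) π) ≡ suc (size π₁ + size πu)
  size-eq = begin
    size (cast env (≈P-sym (trans q q')) π)         ≡⟨ size-cast env (≈P-sym (trans q q')) π ⟩
    suc (suc (size (lam₁ πt') + size πu) + size πs₀) ≡⟨ cong₂ (λ m n → suc (suc (m + size πu) + n))
                                                              (Eq.trans (size-lam₁ πt') (size-cast _ _ πt)) ss ⟩
    suc (suc (size πt + size πu) + size πs)         ≡⟨ shuffle (size πt) (size πu) (size πs) ⟩
    suc (size (appr πt πs e' q') + size πu)         ≡⟨ cong (λ m → suc (m + size πu)) sb ⟩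
    suc (size π₁ + size πu)                         ∎

σ₃-expand : ∀ {Γ₁ Γ₂ Δ P Q Q' t u v} (π₁ : Γ₁ ⊢ lam (app (shift v) t) ∶ ((P ⊸ Q) ∷ [])) (πu : Γ₂ ⊢ u ∶ P)
  (e : Δ ≈E (Γ₁ ⊎ Γ₂)) (q : Q' ≈P Q) (πb : (Γ₁ ▸ P) ⊢ app (shift v) t ∶ Q) → size πb ≡ size π₁ →
  Δ ⊢ app v (app (lam t) u) ∶ Q' # size (appr π₁ πu e q)
σ₃-expand {Γ₂ = Γ₂} {Δ = Δ} {P = P} {t = t} {u = u} {v = v} π₁ πu e q
          (appr {Γ = Γ₃} {Γ' = Γ₄} {P = Pₜ} {Q = Qᵥ} πv πt e' q') sb
  with strengthen 0 v πv
... | z , πv₀ , sv =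
  cast env (≈P-sym (trans q q')) π , size-eq
  where
  πt' : ((Γ₄ ∘ suc) ▸ P) ⊢ t ∶ Pₜ
  πt' = cast (▸-split (≈E-trans e' (comm Γ₃ Γ₄)) z) ≈P-refl πt
  π : ((Γ₃ ∘ suc) ⊎ ((Γ₄ ∘ suc) ⊎ Γ₂)) ⊢ app v (app (lam t) u) ∶ Qᵥ
  π = app₁ πv₀ (app₁ (lam₁ πt') πu)
  env : ((Γ₃ ∘ suc) ⊎ ((Γ₄ ∘ suc) ⊎ Γ₂)) ≈E Δ
  env = ≈E-sym (≈E-trans e (≈E-trans (⊎-cong (e' ∘ suc) (≈E-refl {Γ₂}))
                                      (assoc (Γ₃ ∘ suc) (Γ₄ ∘ suc) Γ₂)))
  shuffle : ∀ a b c → suc (a + suc (b + c)) ≡ suc (suc (a + b) + c)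
  shuffle = solve-∀
  open ≡-Reasoning
  size-eq : size (cast env (≈P-sym (trans q q')) π) ≡ suc (size π₁ + size πu)
  size-eq = begin
    size (cast env (≈P-sym (trans q q')) π)         ≡⟨ size-cast env (≈P-sym (trans q q')) π ⟩
    suc (size πv₀ + suc (size (lam₁ πt') + size πu)) ≡⟨ cong₂ (λ m n → suc (m + suc (n + size πu)))
                                                              sv (Eq.trans (size-lam₁ πt') (size-cast _ _ πt)) ⟩
    suc (size πv + suc (size πt + size πu))         ≡⟨ shuffle (size πv) (size πt) (size πu) ⟩
    suc (size (appr πv πt e' q') + size πu)         ≡⟨ cong (λ m → suc (m + size πu)) sb ⟩
    suc (size π₁ + size πu)                         ∎

↦σ-expands : _↦σ_ Expands-by 0
↦σ-expands σ₁ (appr π₁ πu e q) with lam₁-inv π₁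
... | πb , sb = σ₁-expand π₁ πu e q πb sb
↦σ-expands (σ₃ _) (appr π₁ πu e q) with lam₁-inv π₁
... | πb , sb = σ₃-expand π₁ πu e q πb sb

BalClos-expands : ∀ {_↝_ k} → _↝_ Expands-by k → BalClos _↝_ Expands-by k
BalClos-expands expand (root r) π' = expand r π'
BalClos-expands {k = k} expand (appL r) (appr π₁ π₂ e q) with BalClos-expands expand r π₁
... | π₁' , s = appr π₁' π₂ e q , Eq.trans (cong (λ m → suc (m + size π₂)) s) (shuffle k (size π₁) (size π₂))
  where
  shuffle : ∀ k a b → suc (k + a + b) ≡ k + suc (a + b)
  shuffle = solve-∀
BalClos-expands {k = k} expand (appR r) (appr π₁ π₂ e q) with BalClos-expands expand r π₂
... | π₂' , s = appr π₁ π₂' e q , Eq.trans (cong (λ m → suc (size π₁ + m)) s) (shuffle k (size π₁) (size π₂))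
  where
  shuffle : ∀ k a b → suc (a + (k + b)) ≡ k + suc (a + b)
  shuffle = solve-∀
BalClos-expands {k = k} expand (lamB r) (appr π₁ π₂ e q) with lam₁-inv π₁
... | πb , sb with BalClos-expands expand r πb
...   | πb' , sb' = appr (lam₁ πb') π₂ e q , size-eq
  where
  shuffle : ∀ k a b → suc (k + a + b) ≡ k + suc (a + b)
  shuffle = solve-∀
  open ≡-Reasoning
  size-eq : suc (size (lam₁ πb') + size π₂) ≡ k + size (appr π₁ π₂ e q)
  size-eq = begin
    suc (size (lam₁ πb') + size π₂) ≡⟨ cong (λ m → suc (m + size π₂)) (Eq.trans (size-lam₁ πb') sb') ⟩
    suc (k + size πb + size π₂)     ≡⟨ cong (λ m → suc (k + m + size π₂)) sb ⟩
    suc (k + size π₁ + size π₂)     ≡⟨ shuffle k (size π₁) (size π₂) ⟩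
    k + suc (size π₁ + size π₂)     ∎

→σ̄-reduct-size-pos : t →σ̄ t' → (π' : Δ ⊢ t' ∶ Q) → 0 < size π'
→σ̄-reduct-size-pos (root σ₁)     = app-size-pos
→σ̄-reduct-size-pos (root (σ₃ _)) = app-size-pos
→σ̄-reduct-size-pos (lamB _)      = app-size-pos
→σ̄-reduct-size-pos (appL _)      = app-size-pos
→σ̄-reduct-size-pos (appR _)      = app-size-pos

proposition3p6 : ∀ {Γ t t' Q} (π' : Γ ⊢ t' ∶ Q) →
    (t →β̄v t' → Σ (Γ ⊢ t ∶ Q) (λ π → size π ≡ suc (size π'))) ×
    (t →σ̄ t' → (0 < size π') × Σ (Γ ⊢ t ∶ Q) (λ π → size π ≡ size π'))
proposition3p6 π' =
  (λ r → BalClos-expands ↦βv-expands r π') ,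
  (λ r → →σ̄-reduct-size-pos r π' , BalClos-expands ↦σ-expands r π')
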